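{- Let $G$ be a finite simple cubic graph, $\Pi$ a polyhedral embedding of $G$, and $G^e=G^e(\Pi)$. Let $t_1,t_2,t_3,t_4,t_{4'}$ form a fork in $G^e$. If either $(t_1t_2t_3t_4)$ is the only $3$-path in $G$ between $t_1$ and $t_4$, or $(t_1t_2t_3t_{4'})$ is the only $3$-path in $G$ between $t_1$ and $t_{4'}$, then the disjunction of the fork can be solved.
   Context: An embedding of a graph in a surface without boundary is polyhedral if every facial walk is a cycle and any two distinct facial cycles intersect in either the empty set, a single vertex, or a single edge. A $\Pi$-facial subwalk is a walk formed by consecutive vertices of some $\Pi$-facial cycle (in either direction). The extended graph $G^e(\Pi)$ has vertex set $V(G)$ and edge set $E(G)$ together with a multiset $\mathcal S$ of scaffold edges: for distinct vertices $t_0,t_3$, $[t_0t_3]$ appears with multiplicity equal to the number of paths $(t_0t_1t_2t_3)$ of $G$ that are $\Pi$-facial subwalks. A fork in $G^e$ consists of five distinct vertices $t_1,t_2,t_3,t_4,t_{4'}$ such that $t_1t_2,t_2t_3,t_3t_4,t_3t_{4'}$ are edges of $G$ and $[t_1t_4],[t_1t_{4'}]$ are scaffold edges. Its disjunction is whether $(t_1t_2t_3t_4)$ or $(t_1t_2t_3t_{4'})$ is a facial subwalk; the disjunction can be solved if either every polyhedral embedding $\Pi'$ of $G$ with $G^e(\Pi')=G^e$ has $(t_1t_2t_3t_4)$ as a $\Pi'$-facial subwalk, or every such $\Pi'$ has $(t_1t_2t_3t_{4'})$ as a $\Pi'$-facial subwalk; otherwise it cannot be solved. -}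

module Defs where

open import Data.Bool using (Bool; true; false; _∧_; _∨_; not; if_then_else_; T)
open import Data.Nat using (ℕ; zero; suc; _≤_)
open import Data.Fin using (Fin; _≟_)
open import Data.List using (List; []; _∷_; length; allFin; filterᵇ; map; zip; drop; take; _++_; reverse; upTo)
open import Data.Bool.ListAction using (any)
open import Data.List.Membership.Propositional using (_∈_)
open import Data.List.Relation.Unary.All using (All)
open import Data.List.Relation.Unary.Unique.Propositional using (Unique)
open import Data.Product using (Σ; _×_; _,_; ∃; ∃-syntax)
open import Data.Sum using (_⊎_)
open import Relation.Binary.PropositionalEquality using (_≡_; _≢_)
open import Relation.Nullary using (¬_)
open import Relation.Nullary.Decidable using (⌊_⌋)

record Graph (n : ℕ) : Set where
  field
    adj    : Fin n → Fin n → Bool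
    sym    : ∀ u v → adj u v ≡ adj v u
    irrefl : ∀ v → adj v v ≡ false
open Graph public

Edge : ∀ {n} → Graph n → Fin n → Fin n → Set
Edge G u v = T (adj G u v)

countFin : (m : ℕ) → (Fin m → Bool) → ℕ
countFin m p = length (filterᵇ p (allFin m))

degree : ∀ {n} → Graph n → Fin n → ℕ
degree {n} G v = countFin n (adj G v)

Cubic : ∀ {n} → Graph n → Set
Cubic {n} G = ∀ v → degree G v ≡ 3

data Reach {n} (G : Graph n) : Fin n → Fin n → Set where
  here : ∀ {v} → Reach G v v
  step : ∀ {u v w} → Edge G u v → Reach G v w → Reach G u w

Connected : ∀ {n} → Graph n → Set
Connected G = ∀ u v → Reach G u v

eqF : ∀ {n} → Fin n → Fin n → Bool
eqF u v = ⌊ u ≟ v ⌋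

isPrefixB : ∀ {n} → List (Fin n) → List (Fin n) → Bool
isPrefixB []       _        = true
isPrefixB (x ∷ xs) []       = false
isPrefixB (x ∷ xs) (y ∷ ys) = eqF x y ∧ isPrefixB xs ys

rotate : ∀ {A : Set} → ℕ → List A → List A
rotate k xs = drop k xs ++ take k xs

subwalkDirB : ∀ {n} → List (Fin n) → List (Fin n) → Bool
subwalkDirB c p = any (λ k → isPrefixB p (rotate k c)) (upTo (length c))

subwalkB : ∀ {n} → List (Fin n) → List (Fin n) → Bool
subwalkB c p = subwalkDirB c p ∨ subwalkDirB c (reverse p)

cyclicPairs : ∀ {A : Set} → List A → List (A × A)
cyclicPairs xs = zip xs (rotate 1 xs)

IsCycle : ∀ {n} → Graph n → List (Fin n) → Set
IsCycle G c = (3 ≤ length c) × Unique c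
            × All (λ { (u , v) → Edge G u v }) (cyclicPairs c)

CycleEdge : ∀ {n} → List (Fin n) → Fin n → Fin n → Set
CycleEdge c u v = T (subwalkB c (u ∷ v ∷ []))

MeetProperly : ∀ {n} → List (Fin n) → List (Fin n) → Set
MeetProperly {n} c d =
    (∀ (w : Fin n) → ¬ (w ∈ c × w ∈ d))
  ⊎ (∃[ u ] ∀ (w : Fin n) → ((w ∈ c × w ∈ d) → w ≡ u) × (w ≡ u → w ∈ c × w ∈ d))
  ⊎ (∃[ u ] ∃[ v ] (u ≢ v) × CycleEdge c u v × CycleEdge d u v
       × (∀ (w : Fin n) → (w ∈ c × w ∈ d) → w ≡ u ⊎ w ≡ v))

-- Polyhedral embeddings, described by their (indexed) family of facial
-- cycles.  The faces are cycles of G, every edge of G lies on exactly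
-- two faces (for a cubic graph this forces every vertex link to be a
-- single cycle, so the faces glue to a closed surface), and distinct
-- faces meet in ∅, a vertex or an edge.

record PolyEmb {n : ℕ} (G : Graph n) : Set where
  field
    connected  : Connected G
    m          : ℕ
    face       : Fin m → List (Fin n)
    faceCycle  : ∀ i → IsCycle G (face i)
    edgeTwice  : ∀ u v → Edge G u v →
                 countFin m (λ i → subwalkB (face i) (u ∷ v ∷ [])) ≡ 2
    polyhedral : ∀ i j → i ≢ j → MeetProperly (face i) (face j)
open PolyEmb public

facialB : ∀ {n} {G : Graph n} → PolyEmb G → List (Fin n) → Bool
facialB Π p = any (λ i → subwalkB (face Π i) p) (allFin (m Π))

Facial : ∀ {n} {G : Graph n} → PolyEmb G → List (Fin n) → Set
Facial Π p = T (facialB Π p)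

isPath3B : ∀ {n} → Graph n → Fin n → Fin n → Fin n → Fin n → Bool
isPath3B G a b c d =
  adj G a b ∧ adj G b c ∧ adj G c d
  ∧ not (eqF a b) ∧ not (eqF a c) ∧ not (eqF a d)
  ∧ not (eqF b c) ∧ not (eqF b d) ∧ not (eqF c d)

IsPath3 : ∀ {n} → Graph n → Fin n → Fin n → Fin n → Fin n → Set
IsPath3 G a b c d = T (isPath3B G a b c d)

-- multiplicity of the scaffold edge [t0 t3] in G^e(Π): the number of
-- paths (t0 t1 t2 t3) of G that are Π-facial subwalks
scaffoldMult : ∀ {n} {G : Graph n} → PolyEmb G → Fin n → Fin n → ℕ
scaffoldMult {n} {G} Π t0 t3 =
  countFin n (λ t1 → any (λ t2 → isPath3B G t0 t1 t2 t3
                                ∧ facialB Π (t0 ∷ t1 ∷ t2 ∷ t3 ∷ []))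
                         (allFin n))

-- G^e(Π) = G^e(Π') (same graph G; same scaffold multiset)
SameExt : ∀ {n} {G : Graph n} → PolyEmb G → PolyEmb G → Set
SameExt {n} Π Π' = ∀ (t0 t3 : Fin n) → t0 ≢ t3 →
  scaffoldMult Π t0 t3 ≡ scaffoldMult Π' t0 t3

ScaffoldEdge : ∀ {n} {G : Graph n} → PolyEmb G → Fin n → Fin n → Set
ScaffoldEdge Π u v = (u ≢ v) × (1 ≤ scaffoldMult Π u v)

Fork : ∀ {n} {G : Graph n} → PolyEmb G → (t1 t2 t3 t4 t4' : Fin n) → Set
Fork {G = G} Π t1 t2 t3 t4 t4' =
  Unique (t1 ∷ t2 ∷ t3 ∷ t4 ∷ t4' ∷ [])
  × Edge G t1 t2 × Edge G t2 t3 × Edge G t3 t4 × Edge G t3 t4'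
  × ScaffoldEdge Π t1 t4 × ScaffoldEdge Π t1 t4'

UniquePath3 : ∀ {n} → Graph n → (t1 t2 t3 t4 : Fin n) → Set
UniquePath3 {n} G t1 t2 t3 t4 =
  ∀ (a b : Fin n) → IsPath3 G t1 a b t4 → (a ≡ t2) × (b ≡ t3)

ForkSolvable : ∀ {n} {G : Graph n} → PolyEmb G → (t1 t2 t3 t4 t4' : Fin n) → Set
ForkSolvable {G = G} Π t1 t2 t3 t4 t4' =
    (∀ (Π' : PolyEmb G) → SameExt Π Π' → Facial Π' (t1 ∷ t2 ∷ t3 ∷ t4 ∷ []))
  ⊎ (∀ (Π' : PolyEmb G) → SameExt Π Π' → Facial Π' (t1 ∷ t2 ∷ t3 ∷ t4' ∷ []))

module Submission where

-- A scaffold edge [t1 t4] of positive multiplicity in G^e(Π')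
-- is, by definition, witnessed by some 3-path (t1 a b t4) of G that is a
-- Π'-facial subwalk.  Every embedding Π' with G^e(Π') = G^e(Π) has the same
-- scaffold multiplicities as Π, so a scaffold edge of the fork persists in
-- Π'.  If (t1 t2 t3 t4) is the only 3-path of G between t1 and t4, the
-- witness must be that path, so it is Π'-facial for every such Π'; this
-- solves the disjunction, and symmetrically for t4'.

open import Defs
open import Data.Nat using (ℕ; _≤_)
open import Data.Fin using (Fin)
open import Data.Bool using (Bool; T)
open import Data.Bool.ListAction using (any)
open import Data.Bool.Properties using (T-∧; T?)
open import Data.List using (List; []; _∷_; length; filterᵇ; allFin)
open import Data.List.Membership.Propositional using (_∈_)
open import Data.List.Membership.Propositional.Properties using (∈-filter⁻)
open import Data.List.Relation.Unary.Any using (here; satisfied)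
open import Data.List.Relation.Unary.Any.Properties using (any⁻)
open import Data.Product using (Σ; ∃; _×_; _,_; proj₂)
open import Data.Sum using (_⊎_; inj₁; inj₂)
open import Function using (_∘_; Equivalence)
open import Relation.Binary.PropositionalEquality using (refl; subst)

module _ {A : Set} where

  nonempty⇒member : (ys : List A) → 1 ≤ length ys → ∃ (_∈ ys)
  nonempty⇒member (y ∷ _) _ = y , here refl

  filterᵇ-nonempty⇒witness : (p : A → Bool) (xs : List A) →
    1 ≤ length (filterᵇ p xs) → ∃ (T ∘ p)
  filterᵇ-nonempty⇒witness p xs nonempty with nonempty⇒member (filterᵇ p xs) nonempty
  ... | x , x∈filter = x , proj₂ (∈-filter⁻ (T? ∘ p) {xs = xs} x∈filter)

  any⇒witness : (p : A → Bool) (xs : List A) → T (any p xs) → ∃ (T ∘ p)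
  any⇒witness p xs = satisfied ∘ any⁻ p xs

scaffold⇒facialPath : ∀ {n} {G : Graph n} (Π : PolyEmb G) (t0 t3 : Fin n) →
  1 ≤ scaffoldMult Π t0 t3 →
  Σ (Fin n) λ a → Σ (Fin n) λ b →
    IsPath3 G t0 a b t3 × Facial Π (t0 ∷ a ∷ b ∷ t3 ∷ [])
scaffold⇒facialPath {n} Π t0 t3 positive
  with filterᵇ-nonempty⇒witness _ (allFin n) positive
... | a , someB with any⇒witness _ (allFin n) someB
... | b , pathAndFacial = a , b , Equivalence.to T-∧ pathAndFacial

scaffoldEdge-transfer : ∀ {n} {G : Graph n} (Π Π' : PolyEmb G) {u v : Fin n} →
  SameExt Π Π' → ScaffoldEdge Π u v → ScaffoldEdge Π' u v
scaffoldEdge-transfer Π Π' {u} {v} same (u≢v , positive) =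
  u≢v , subst (1 ≤_) (same u v u≢v) positive

uniquePath⇒facial : ∀ {n} {G : Graph n} (Π' : PolyEmb G) (t1 t2 t3 t4 : Fin n) →
  ScaffoldEdge Π' t1 t4 → UniquePath3 G t1 t2 t3 t4 →
  Facial Π' (t1 ∷ t2 ∷ t3 ∷ t4 ∷ [])
uniquePath⇒facial Π' t1 t2 t3 t4 (_ , positive) unique
  with scaffold⇒facialPath Π' t1 t4 positive
... | a , b , path , facial with unique a b path
... | refl , refl = facial

uniquePath⇒alwaysFacial : ∀ {n} {G : Graph n} (Π : PolyEmb G) (t1 t2 t3 t4 : Fin n) →
  ScaffoldEdge Π t1 t4 → UniquePath3 G t1 t2 t3 t4 →
  ∀ (Π' : PolyEmb G) → SameExt Π Π' → Facial Π' (t1 ∷ t2 ∷ t3 ∷ t4 ∷ [])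
uniquePath⇒alwaysFacial Π t1 t2 t3 t4 scaffold unique Π' same =
  uniquePath⇒facial Π' t1 t2 t3 t4 (scaffoldEdge-transfer Π Π' same scaffold) unique

lemma14 : ∀ {n : ℕ} (G : Graph n) → Cubic G → (Π : PolyEmb G)
          → (t1 t2 t3 t4 t4' : Fin n) → Fork Π t1 t2 t3 t4 t4'
          → UniquePath3 G t1 t2 t3 t4 ⊎ UniquePath3 G t1 t2 t3 t4'
          → ForkSolvable Π t1 t2 t3 t4 t4'
lemma14 G _ Π t1 t2 t3 t4 t4' (_ , _ , _ , _ , _ , scaffold₄ , scaffold₄') (inj₁ unique₄) =
  inj₁ (uniquePath⇒alwaysFacial Π t1 t2 t3 t4 scaffold₄ unique₄)
lemma14 G _ Π t1 t2 t3 t4 t4' (_ , _ , _ , _ , _ , scaffold₄ , scaffold₄') (inj₂ unique₄') =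
  inj₂ (uniquePath⇒alwaysFacial Π t1 t2 t3 t4' scaffold₄' unique₄')
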